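{- Let $G$ be a graph on $n$ vertices with $\underline{f}(G)=2$. If $\beta\ge 1/2$, then every minimum power dominating set of $G$ is $\beta$-best.
   Context: Graphs are finite and simple. Power domination: from $S\subseteq V(G)$, first $N[S]$ is observed; then repeatedly, while an observed vertex has exactly one unobserved neighbor, that neighbor becomes observed; the final set is $\mathrm{Obs}(G;S)$. $S$ is a power dominating set if $\mathrm{Obs}(G;S)=V(G)$; $\gamma_P(G)$ is the minimum size of one. For $\beta\ge0$, $\mathrm{C}(G;S,\beta)=|S|+\beta(|V(G)|-|\mathrm{Obs}(G;S)|)$; $S$ is $\beta$-best if it minimizes $\mathrm{C}(G;\cdot,\beta)$ over all subsets of $V(G)$. A fort is a nonempty $F\subseteq V(G)$ such that no vertex of $V(G)\setminus F$ has exactly one neighbor in $F$; $\underline{f}(G)$ is the minimum size of a fort.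
   Formalization: The parameter β ranges over the rationals. -}

module Defs where

open import Data.Bool using (Bool; true; false; _∧_; _∨_; not; if_then_else_)
open import Data.Nat using (ℕ; zero; suc; _+_; _∸_; _≤_)
open import Data.Fin using (Fin)
open import Data.Vec using (Vec; lookup; tabulate)
open import Data.Fin.Subset using (Subset; ∣_∣; Nonempty)
open import Data.Integer using (+_)
open import Data.Rational using (ℚ; _/_) renaming (_+_ to _+ℚ_; _*_ to _*ℚ_; _≤_ to _≤ℚ_)
open import Data.Product using (Σ; _×_; _,_)
open import Relation.Binary.PropositionalEquality using (_≡_)
open import Relation.Nullary using (¬_)

record Graph (n : ℕ) : Set where
  field
    adj   : Fin n → Fin n → Bool
    sym   : ∀ u v → adj u v ≡ adj v u
    irrefl : ∀ v → adj v v ≡ false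
open Graph public

count : {n : ℕ} → (Fin n → Bool) → ℕ
count {zero}  p = 0
count {suc n} p = (if p Fin.zero then 1 else 0) + count {n} (λ i → p (Fin.suc i))

any : {n : ℕ} → (Fin n → Bool) → Bool
any {zero}  p = false
any {suc n} p = p Fin.zero ∨ any {n} (λ i → p (Fin.suc i))

closedNbhd : {n : ℕ} → Graph n → Subset n → Subset n
closedNbhd G S = tabulate λ v → lookup S v ∨ any (λ u → lookup S u ∧ adj G u v)

step : {n : ℕ} → Graph n → Subset n → Subset n
step G O = tabulate λ v → lookup O v ∨
  any (λ u → lookup O u ∧ adj G u v ∧ not (lookup O v) ∧
             Data.Nat._≡ᵇ_ (count (λ w → adj G u w ∧ not (lookup O w))) 1)

iterate : {A : Set} → ℕ → (A → A) → A → A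
iterate zero    f x = x
iterate (suc k) f x = iterate k f (f x)

-- Obs(G;S): the propagation is monotone and stabilises after at most n rounds
-- (each non-stable round adds a vertex), so n rounds give the final set.
Obs : {n : ℕ} → Graph n → Subset n → Subset n
Obs {n} G S = iterate n (step G) (closedNbhd G S)

IsPowerDominating : {n : ℕ} → Graph n → Subset n → Set
IsPowerDominating {n} G S = ∀ v → lookup (Obs G S) v ≡ true

IsMinPowerDominating : {n : ℕ} → Graph n → Subset n → Set
IsMinPowerDominating G S =
  IsPowerDominating G S × (∀ T → IsPowerDominating G T → ∣ S ∣ ≤ ∣ T ∣)

ℕtoℚ : ℕ → ℚ
ℕtoℚ k = (+ k) / 1

cost : {n : ℕ} → Graph n → Subset n → ℚ → ℚ
cost {n} G S β = ℕtoℚ ∣ S ∣ +ℚ (β *ℚ ℕtoℚ (n ∸ ∣ Obs G S ∣))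

IsBetaBest : {n : ℕ} → Graph n → ℚ → Subset n → Set
IsBetaBest G β S = ∀ T → cost G S β ≤ℚ cost G T β

IsFort : {n : ℕ} → Graph n → Subset n → Set
IsFort G F = Nonempty F ×
  (∀ v → lookup F v ≡ false → ¬ (count (λ u → adj G v u ∧ lookup F u) ≡ 1))

MinFortSize : {n : ℕ} → Graph n → ℕ → Set
MinFortSize G k = Σ (Subset _) (λ F → IsFort G F × ∣ F ∣ ≡ k)
                × (∀ F → IsFort G F → k ≤ ∣ F ∣)

-- A fort of size 1 is exactly an isolated vertex, so the hypothesis says that
-- G has no isolated vertices. Then any set T that fails to power dominate can
-- be enlarged by one vertex so that at least two more vertices are observed:
-- an unobserved vertex u has a neighbour y; if y is unobserved, add u; if y is
-- observed, then, since the final observed set admits no further forcing, y has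
-- a second unobserved neighbour besides u, and we add y. Repeating until T
-- power dominates shows 2 γ_P(G) ≤ 2 |T| + (n - |Obs(G;T)|), i.e. a minimum
-- power dominating set costs at most C(G;T,½) ≤ C(G;T,β).
module Submission where

open import Defs hiding (sym)

-- A separate scope, so that the ℕ operators used here do not clash with the ℚ
-- operators in the type of proposition3p8.
module PowerDomination where

  open import Data.Bool using (Bool; true; false; _∧_; _∨_; not; T)
  open import Data.Bool.Properties using (∧-zeroʳ; ¬-not) renaming (_≟_ to _≟ᵇ_)
  open import Data.Fin using (Fin; zero; suc; _≟_)
  open import Data.Fin.Properties using (any?; all?; ¬∀⟶∃¬)
  open import Data.Fin.Subset using (Subset; ∣_∣; _∈_; _∉_; _⊆_; _⊂_; _∪_; ⁅_⁆; ⊤)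
  open import Data.Fin.Subset.Properties
    using (_∈?_; _⊂?_; ⊆-refl; ⊆-trans; ⊆-antisym; ⊆-reflexive; ⊆⊤; ∣p∣≤n; ∣p∣≡n⇒p≡⊤; ∣⊤∣≡n;
           p⊆q⇒∣p∣≤∣q∣; p⊂q⇒∣p∣<∣q∣; x∈⁅x⁆; x∈⁅y⁆⇒x≡y; ∣⁅x⁆∣≡1; p⊆p∪q; q⊆p∪q; x∈p∪q⁺; x∈p∪q⁻)
  import Data.Integer as ℤ
  import Data.Integer.Properties as ℤ
  open import Data.Nat using (ℕ; zero; suc; _+_; _*_; _∸_; _≤_; _<_; _≡ᵇ_; s≤s)
  open import Data.Nat.Properties
    using (≤-refl; ≤-trans; ≤-reflexive; ≤-antisym; +-identityʳ; +-suc; +-comm; +-monoˡ-≤; +-monoʳ-≤;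
           *-monoʳ-≤; m≤m+n; m≤n+m; n≤1+n; ≡ᵇ⇒≡; n∸n≡0; +-∸-assoc; ∸-monoʳ-≤; [m+n]∸[m+o]≡n∸o;
           module ≤-Reasoning)
  open import Data.Nat.Tactic.RingSolver using (solve-∀)
  open import Data.Nat.Coprimality using (1-coprimeTo) renaming (sym to coprime-sym)
  open import Data.Product using (∃; ∃₂; _×_; _,_; proj₂)
  open import Data.Rational using (ℚ; mkℚ; ½; toℚᵘ) renaming (_+_ to _+ℚ_; _*_ to _*ℚ_; _≤_ to _≤ℚ_)
  import Data.Rational.Properties as ℚ
  import Data.Rational.Unnormalised as ℚᵘ
  import Data.Rational.Unnormalised.Properties as ℚᵘ
  open import Data.Sum using (_⊎_; inj₁; inj₂; [_,_])
  open import Data.Vec using (lookup; tabulate; []; _∷_)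
  open import Data.Vec.Properties using (lookup∘tabulate; []=⇒lookup; lookup⇒[]=)
  open import Function using (_∘_)
  open import Data.Nat.Induction using (<-wellFounded)
  open import Induction.WellFounded using (Acc; acc)
  open import Relation.Binary.PropositionalEquality
    using (_≡_; _≢_; refl; sym; trans; cong; subst; ≢-sym; module ≡-Reasoning)
  open import Relation.Nullary using (¬_; yes; no; contradiction)
  open import Relation.Nullary.Decidable using (_×-dec_; ¬?; decidable-stable)

  ∧-true⁺ : ∀ {a b} → a ≡ true → b ≡ true → a ∧ b ≡ true
  ∧-true⁺ refl refl = refl

  ∧-true⁻ : ∀ {a b} → a ∧ b ≡ true → a ≡ true × b ≡ true
  ∧-true⁻ {true} refl = refl , refl

  ∨-true⁺ˡ : ∀ {a b} → a ≡ true → a ∨ b ≡ true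
  ∨-true⁺ˡ refl = refl

  ∨-true⁺ʳ : ∀ {a b} → b ≡ true → a ∨ b ≡ true
  ∨-true⁺ʳ {true}  _ = refl
  ∨-true⁺ʳ {false} e = e

  ∨-true⁻ : ∀ {a b} → a ∨ b ≡ true → a ≡ true ⊎ b ≡ true
  ∨-true⁻ {true}  _ = inj₁ refl
  ∨-true⁻ {false} e = inj₂ e

  not-true⁻ : ∀ {a} → not a ≡ true → a ≡ false
  not-true⁻ {false} _ = refl

  ≡ᵇ-true⁻ : ∀ {m n} → (m ≡ᵇ n) ≡ true → m ≡ n
  ≡ᵇ-true⁻ {m} {n} e = ≡ᵇ⇒≡ m n (subst T (sym e) _)

  any-true⁺ : ∀ {n} (p : Fin n → Bool) {u} → p u ≡ true → any p ≡ true
  any-true⁺ p {zero}  e rewrite e = refl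
  any-true⁺ p {suc u} e with p zero
  ... | true  = refl
  ... | false = any-true⁺ (p ∘ suc) e

  any-true⁻ : ∀ {n} (p : Fin n → Bool) → any p ≡ true → ∃ λ u → p u ≡ true
  any-true⁻ {suc n} p e with p zero in p0
  ... | true  = zero , p0
  ... | false with any-true⁻ (p ∘ suc) e
  ...   | u , pu = suc u , pu

  ∣p∪q∣≤∣p∣+∣q∣ : ∀ {n} (p q : Subset n) → ∣ p ∪ q ∣ ≤ ∣ p ∣ + ∣ q ∣
  ∣p∪q∣≤∣p∣+∣q∣ [] [] = ≤-refl
  ∣p∪q∣≤∣p∣+∣q∣ (true  ∷ p) (false ∷ q) = s≤s (∣p∪q∣≤∣p∣+∣q∣ p q)
  ∣p∪q∣≤∣p∣+∣q∣ (true  ∷ p) (true  ∷ q) =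
    s≤s (≤-trans (∣p∪q∣≤∣p∣+∣q∣ p q) (+-monoʳ-≤ ∣ p ∣ (n≤1+n ∣ q ∣)))
  ∣p∪q∣≤∣p∣+∣q∣ (false ∷ p) (false ∷ q) = ∣p∪q∣≤∣p∣+∣q∣ p q
  ∣p∪q∣≤∣p∣+∣q∣ (false ∷ p) (true  ∷ q) =
    ≤-trans (s≤s (∣p∪q∣≤∣p∣+∣q∣ p q)) (≤-reflexive (sym (+-suc ∣ p ∣ ∣ q ∣)))

  2*[1+m]+n≡2*m+[2+n] : ∀ m n → 2 * suc m + n ≡ 2 * m + (2 + n)
  2*[1+m]+n≡2*m+[2+n] = solve-∀

  m+a≤b⇒m+[n∸b]≤n∸a : ∀ m {a b n} → m + a ≤ b → b ≤ n → m + (n ∸ b) ≤ n ∸ a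
  m+a≤b⇒m+[n∸b]≤n∸a m {a} {b} {n} m+a≤b b≤n = begin
    m + (n ∸ b)      ≡⟨ +-∸-assoc m b≤n ⟨
    m + n ∸ b        ≤⟨ ∸-monoʳ-≤ (m + n) m+a≤b ⟩
    m + n ∸ (m + a)  ≡⟨ [m+n]∸[m+o]≡n∸o m n a ⟩
    n ∸ a            ∎
    where open ≤-Reasoning

  count≡∣tabulate∣ : ∀ {n} (p : Fin n → Bool) → count p ≡ ∣ tabulate p ∣
  count≡∣tabulate∣ {zero}  p = refl
  count≡∣tabulate∣ {suc n} p with p zero
  ... | true  = cong suc (count≡∣tabulate∣ (p ∘ suc))
  ... | false = count≡∣tabulate∣ (p ∘ suc)

  count-none : ∀ {n} {p : Fin n → Bool} → (∀ x → p x ≡ false) → count p ≡ 0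
  count-none {zero}      _    = refl
  count-none {suc n} {p} none rewrite none zero = count-none (none ∘ suc)

  module _ {n : ℕ} where

    ∈⇒lookup : ∀ {p : Subset n} {x} → x ∈ p → lookup p x ≡ true
    ∈⇒lookup = []=⇒lookup

    lookup⇒∈ : ∀ {p : Subset n} {x} → lookup p x ≡ true → x ∈ p
    lookup⇒∈ = lookup⇒[]= _ _

    ∉⇒lookup : ∀ {p : Subset n} {x} → x ∉ p → lookup p x ≡ false
    ∉⇒lookup x∉p = ¬-not (x∉p ∘ lookup⇒∈)

    lookup⇒∉ : ∀ {p : Subset n} {x} → lookup p x ≡ false → x ∉ p
    lookup⇒∉ e x∈p with trans (sym (∈⇒lookup x∈p)) e
    ... | ()

    ∈-tabulate⁺ : ∀ {f : Fin n → Bool} {x} → f x ≡ true → x ∈ tabulate f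
    ∈-tabulate⁺ {f} {x} e = lookup⇒∈ (trans (lookup∘tabulate f x) e)

    ∈-tabulate⁻ : ∀ {f : Fin n → Bool} {x} → x ∈ tabulate f → f x ≡ true
    ∈-tabulate⁻ {f} {x} x∈ = trans (sym (lookup∘tabulate f x)) (∈⇒lookup x∈)

    ¬⊂⇒⊇ : ∀ {p q : Subset n} → p ⊆ q → ¬ p ⊂ q → q ⊆ p
    ¬⊂⇒⊇ {p} p⊆q p⊄q {x} x∈q with x ∈? p
    ... | yes x∈p = x∈p
    ... | no  x∉p = contradiction ((λ {y} → p⊆q {y}) , x , x∈q , x∉p) p⊄q

    ∣p∣+2≤∣q∣ : ∀ {p q : Subset n} {a b} → p ⊆ q → a ≢ b → a ∉ p → b ∉ p → a ∈ q → b ∈ q →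
                2 + ∣ p ∣ ≤ ∣ q ∣
    ∣p∣+2≤∣q∣ {p} {q} {a} {b} p⊆q a≢b a∉p b∉p a∈q b∈q =
      ≤-trans (s≤s (p⊂q⇒∣p∣<∣q∣ p⊂p+a)) (p⊂q⇒∣p∣<∣q∣ p+a⊂q)
      where
      p+a⊆q : p ∪ ⁅ a ⁆ ⊆ q
      p+a⊆q x∈ = [ p⊆q , (λ x∈⁅a⁆ → subst (_∈ q) (sym (x∈⁅y⁆⇒x≡y a x∈⁅a⁆)) a∈q) ] (x∈p∪q⁻ p ⁅ a ⁆ x∈)
      b∉p+a : b ∉ p ∪ ⁅ a ⁆
      b∉p+a = [ b∉p , (λ b∈⁅a⁆ → a≢b (sym (x∈⁅y⁆⇒x≡y a b∈⁅a⁆))) ] ∘ x∈p∪q⁻ p ⁅ a ⁆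
      p⊂p+a : p ⊂ p ∪ ⁅ a ⁆
      p⊂p+a = p⊆p∪q ⁅ a ⁆ , a , x∈p∪q⁺ (inj₂ (x∈⁅x⁆ a)) , a∉p
      p+a⊂q : p ∪ ⁅ a ⁆ ⊂ q
      p+a⊂q = p+a⊆q , b , b∈q , b∉p+a

    count-mono : ∀ {p q : Fin n → Bool} → (∀ {x} → p x ≡ true → q x ≡ true) → count p ≤ count q
    count-mono {p} {q} p⇒q rewrite count≡∣tabulate∣ p | count≡∣tabulate∣ q =
      p⊆q⇒∣p∣≤∣q∣ (∈-tabulate⁺ ∘ p⇒q ∘ ∈-tabulate⁻)

    count-pos : ∀ {p : Fin n → Bool} {u} → p u ≡ true → 1 ≤ count p
    count-pos {p} {u} pu rewrite count≡∣tabulate∣ p | sym (∣⁅x⁆∣≡1 u) =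
      p⊆q⇒∣p∣≤∣q∣ (λ x∈⁅u⁆ → ∈-tabulate⁺ (subst (λ x → p x ≡ true) (sym (x∈⁅y⁆⇒x≡y u x∈⁅u⁆)) pu))

    count-unique : ∀ {p : Fin n → Bool} {u} → p u ≡ true → (∀ {x} → p x ≡ true → x ≡ u) → count p ≡ 1
    count-unique {p} {u} pu only-u = ≤-antisym (subst (count p ≤_) (∣⁅x⁆∣≡1 u) p≤⁅u⁆) (count-pos pu)
      where
      p≤⁅u⁆ : count p ≤ ∣ ⁅ u ⁆ ∣
      p≤⁅u⁆ rewrite count≡∣tabulate∣ p =
        p⊆q⇒∣p∣≤∣q∣ (λ x∈p → subst (_∈ ⁅ u ⁆) (sym (only-u (∈-tabulate⁻ x∈p))) (x∈⁅x⁆ u))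

    count≡1-⊆ : ∀ {p q : Fin n → Bool} {u} → (∀ {x} → p x ≡ true → q x ≡ true) → p u ≡ true →
                count q ≡ 1 → count p ≡ 1
    count≡1-⊆ {p} p⇒q pu q≡1 = ≤-antisym (subst (count p ≤_) q≡1 (count-mono p⇒q)) (count-pos pu)

  module _ {ℓ} {A : Set} (_≼_ : A → A → Set ℓ) (f : A → A) where

    iterate-inflationary : (∀ {x} → x ≼ x) → (∀ {x y z} → x ≼ y → y ≼ z → x ≼ z) →
                           (∀ {x} → x ≼ f x) → ∀ k {x} → x ≼ iterate k f x
    iterate-inflationary refl≼ _      _      zero    = refl≼
    iterate-inflationary refl≼ trans≼ infl-f (suc k) =
      trans≼ infl-f (iterate-inflationary refl≼ trans≼ infl-f k)

    iterate-monotone : (∀ {x y} → x ≼ y → f x ≼ f y) → ∀ k {x y} → x ≼ y → iterate k f x ≼ iterate k f y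
    iterate-monotone mono-f zero    x≼y = x≼y
    iterate-monotone mono-f (suc k) x≼y = iterate-monotone mono-f k (mono-f x≼y)

  iterate-fixed : ∀ {A : Set} (f : A → A) {x} k → f x ≡ x → iterate k f x ≡ x
  iterate-fixed f zero    _    = refl
  iterate-fixed f (suc k) fx≡x rewrite fx≡x = iterate-fixed f k fx≡x

  -- An inflationary map on Subset n either grows its argument or fixes it, and it
  -- can grow only n times.
  iterate-stabilises : ∀ {n} (f : Subset n → Subset n) → (∀ {X} → X ⊆ f X) →
                       ∀ k X → n ≤ ∣ X ∣ + k → f (iterate k f X) ⊆ iterate k f X
  iterate-stabilises {n} f infl zero X n≤∣X∣+0 = ⊆-trans ⊆⊤ (⊆-reflexive (sym X≡⊤))
    where
    X≡⊤ : X ≡ ⊤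
    X≡⊤ = ∣p∣≡n⇒p≡⊤ (≤-antisym (∣p∣≤n X) (subst (n ≤_) (+-identityʳ ∣ X ∣) n≤∣X∣+0))
  iterate-stabilises {n} f infl (suc k) X n≤ with X ⊂? f X
  ... | yes X⊂fX = iterate-stabilises f infl k (f X)
                     (≤-trans n≤ (≤-trans (≤-reflexive (+-suc ∣ X ∣ k)) (+-monoˡ-≤ k (p⊂q⇒∣p∣<∣q∣ X⊂fX))))
  ... | no  X⊄fX = subst (λ Y → f Y ⊆ Y) (sym (iterate-fixed f (suc k) fX≡X)) (⊆-reflexive fX≡X)
    where
    fX≡X : f X ≡ X
    fX≡X = ⊆-antisym (¬⊂⇒⊇ infl X⊄fX) infl

  module _ {n : ℕ} (G : Graph n) where

    unobservedNeighbours : Subset n → Fin n → Fin n → Bool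
    unobservedNeighbours O u w = adj G u w ∧ not (lookup O w)

    unobserved⁺ : ∀ {O u w} → adj G u w ≡ true → w ∉ O → unobservedNeighbours O u w ≡ true
    unobserved⁺ uw w∉O = ∧-true⁺ uw (cong not (∉⇒lookup w∉O))

    unobserved⁻ : ∀ {O u w} → unobservedNeighbours O u w ≡ true → adj G u w ≡ true × w ∉ O
    unobserved⁻ e with ∧-true⁻ e
    ... | uw , w∉O = uw , lookup⇒∉ (not-true⁻ w∉O)

    Forces : Subset n → Fin n → Fin n → Set
    Forces O u v = u ∈ O × adj G u v ≡ true × v ∉ O × count (unobservedNeighbours O u) ≡ 1

    -- the predicate under `any` in the definition of step G O at v
    forcedBy : Subset n → Fin n → Fin n → Bool
    forcedBy O v u = lookup O u ∧ adj G u v ∧ not (lookup O v) ∧ (count (unobservedNeighbours O u) ≡ᵇ 1)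

    ∈-step⁺ : ∀ {O u v} → Forces O u v → v ∈ step G O
    ∈-step⁺ {O} {u} {v} (u∈O , uv , v∉O , one) =
      ∈-tabulate⁺ (∨-true⁺ʳ (any-true⁺ (forcedBy O v) forced))
      where
      forced : forcedBy O v u ≡ true
      forced = ∧-true⁺ (∈⇒lookup u∈O) (∧-true⁺ uv (∧-true⁺ (cong not (∉⇒lookup v∉O)) (cong (_≡ᵇ 1) one)))

    ∈-step⁻ : ∀ {O v} → v ∈ step G O → v ∈ O ⊎ ∃ λ u → Forces O u v
    ∈-step⁻ {O} {v} v∈ with ∨-true⁻ (∈-tabulate⁻ v∈)
    ... | inj₁ v∈O = inj₁ (lookup⇒∈ v∈O)
    ... | inj₂ forced with any-true⁻ (forcedBy O v) forced
    ...   | u , e with ∧-true⁻ e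
    ...     | u∈O , e′ with ∧-true⁻ e′
    ...       | uv , e″ with ∧-true⁻ e″
    ...         | v∉O , one = inj₂ (u , lookup⇒∈ u∈O , uv , lookup⇒∉ (not-true⁻ v∉O) , ≡ᵇ-true⁻ one)

    step-inflationary : ∀ {O} → O ⊆ step G O
    step-inflationary v∈O = ∈-tabulate⁺ (∨-true⁺ˡ (∈⇒lookup v∈O))

    Forces-mono : ∀ {O O′ u v} → O ⊆ O′ → v ∉ O′ → Forces O u v → Forces O′ u v
    Forces-mono {O} {O′} {u} O⊆O′ v∉O′ (u∈O , uv , _ , one) =
      O⊆O′ u∈O , uv , v∉O′ ,
      count≡1-⊆ {p = unobservedNeighbours O′ u} {q = unobservedNeighbours O u}
                shrink (unobserved⁺ uv v∉O′) one
      where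
      shrink : ∀ {w} → unobservedNeighbours O′ u w ≡ true → unobservedNeighbours O u w ≡ true
      shrink e with unobserved⁻ e
      ... | uw , w∉O′ = unobserved⁺ uw (w∉O′ ∘ O⊆O′)

    step-monotone : ∀ {O O′} → O ⊆ O′ → step G O ⊆ step G O′
    step-monotone {O} {O′} O⊆O′ {v} v∈ with v ∈? O′
    ... | yes v∈O′ = step-inflationary v∈O′
    ... | no  v∉O′ with ∈-step⁻ v∈
    ...   | inj₁ v∈O        = contradiction (O⊆O′ v∈O) v∉O′
    ...   | inj₂ (u , u→v) = ∈-step⁺ (Forces-mono O⊆O′ v∉O′ u→v)

    closedNbhd-self : ∀ {S w} → w ∈ S → w ∈ closedNbhd G S
    closedNbhd-self w∈S = ∈-tabulate⁺ (∨-true⁺ˡ (∈⇒lookup w∈S))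

    closedNbhd-neighbour : ∀ {S w v} → w ∈ S → adj G w v ≡ true → v ∈ closedNbhd G S
    closedNbhd-neighbour {S} {w} {v} w∈S wv =
      ∈-tabulate⁺ (∨-true⁺ʳ (any-true⁺ (λ u → lookup S u ∧ adj G u v) (∧-true⁺ (∈⇒lookup w∈S) wv)))

    closedNbhd-monotone : ∀ {S S′} → S ⊆ S′ → closedNbhd G S ⊆ closedNbhd G S′
    closedNbhd-monotone {S} S⊆S′ {v} v∈ with ∨-true⁻ (∈-tabulate⁻ v∈)
    ... | inj₁ v∈S = closedNbhd-self (S⊆S′ (lookup⇒∈ v∈S))
    ... | inj₂ near with any-true⁻ (λ u → lookup S u ∧ adj G u v) near
    ...   | w , e with ∧-true⁻ e
    ...     | w∈S , wv = closedNbhd-neighbour (S⊆S′ (lookup⇒∈ w∈S)) wv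

    closedNbhd⊆Obs : ∀ {S} → closedNbhd G S ⊆ Obs G S
    closedNbhd⊆Obs = iterate-inflationary _⊆_ (step G) ⊆-refl ⊆-trans step-inflationary n

    Obs-monotone : ∀ {S S′} → S ⊆ S′ → Obs G S ⊆ Obs G S′
    Obs-monotone S⊆S′ = iterate-monotone _⊆_ (step G) step-monotone n (closedNbhd-monotone S⊆S′)

    Obs-closed : ∀ {S} → step G (Obs G S) ⊆ Obs G S
    Obs-closed {S} = iterate-stabilises (step G) step-inflationary n (closedNbhd G S) (m≤n+m n _)

    second-unobserved : ∀ {O y u} → step G O ⊆ O → y ∈ O → adj G y u ≡ true → u ∉ O →
                        ∃ λ u′ → u′ ≢ u × adj G y u′ ≡ true × u′ ∉ O
    second-unobserved {O} {y} {u} closed y∈O yu u∉O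
      with any? (λ w → ¬? (w ≟ u) ×-dec (unobservedNeighbours O y w ≟ᵇ true))
    ... | yes (u′ , u′≢u , e) = u′ , u′≢u , unobserved⁻ e
    ... | no none = contradiction (closed (∈-step⁺ (y∈O , yu , u∉O , only-u-unobserved))) u∉O
      where
      only-u-unobserved : count (unobservedNeighbours O y) ≡ 1
      only-u-unobserved = count-unique (unobserved⁺ yu u∉O)
        (λ {w} e → decidable-stable (w ≟ u) (λ w≢u → none (w , w≢u , e)))

    NoIsolatedVertex : Set
    NoIsolatedVertex = ∀ u → ∃ λ v → adj G u v ≡ true

    isolated⇒fort : ∀ {u} → (∀ v → adj G u v ≡ false) → IsFort G ⁅ u ⁆
    isolated⇒fort {u} isolated =
      (u , x∈⁅x⁆ u) , λ v _ one → contradiction (trans (sym (count-none (none v))) one) λ ()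
      where
      none : ∀ v w → adj G v w ∧ lookup ⁅ u ⁆ w ≡ false
      none v w with lookup ⁅ u ⁆ w in e
      ... | false = ∧-zeroʳ _
      ... | true rewrite x∈⁅y⁆⇒x≡y u (lookup⇒∈ e) | Graph.sym G v u | isolated v = refl

    forts-nontrivial⇒NoIsolatedVertex : (∀ F → IsFort G F → 2 ≤ ∣ F ∣) → NoIsolatedVertex
    forts-nontrivial⇒NoIsolatedVertex nontrivial u with any? (λ v → adj G u v ≟ᵇ true)
    ... | yes neighbour = neighbour
    ... | no  isolated  =
      contradiction (subst (2 ≤_) (∣⁅x⁆∣≡1 u) (nontrivial ⁅ u ⁆ ⁅u⁆-fort)) λ { (s≤s ()) }
      where
      ⁅u⁆-fort : IsFort G ⁅ u ⁆
      ⁅u⁆-fort = isolated⇒fort (λ v → ¬-not (λ uv → isolated (v , uv)))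

    two-unobserved-near : NoIsolatedVertex → ∀ {O u} → step G O ⊆ O → u ∉ O →
      ∃ λ w → ∃₂ λ a b → a ≢ b × a ∉ O × b ∉ O × a ∈ closedNbhd G ⁅ w ⁆ × b ∈ closedNbhd G ⁅ w ⁆
    two-unobserved-near noIsolated {O} {u} closed u∉O with noIsolated u
    ... | y , uy with y ∈? O
    ...   | no y∉O =
      u , u , y , u≢y , u∉O , y∉O , closedNbhd-self (x∈⁅x⁆ u) , closedNbhd-neighbour (x∈⁅x⁆ u) uy
      where
      u≢y : u ≢ y
      u≢y refl = contradiction (trans (sym uy) (irrefl G u)) λ ()
    ...   | yes y∈O with trans (Graph.sym G y u) uy
    ...     | yu with second-unobserved closed y∈O yu u∉O
    ...       | u′ , u′≢u , yu′ , u′∉O =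
      y , u , u′ , ≢-sym u′≢u , u∉O , u′∉O ,
      closedNbhd-neighbour (x∈⁅x⁆ y) yu , closedNbhd-neighbour (x∈⁅x⁆ y) yu′

    add-vertex-observes-two : NoIsolatedVertex → ∀ {T u} → u ∉ Obs G T →
      ∃ λ T′ → ∣ T′ ∣ ≤ suc ∣ T ∣ × 2 + ∣ Obs G T ∣ ≤ ∣ Obs G T′ ∣
    add-vertex-observes-two noIsolated {T} u∉Obs
      with two-unobserved-near noIsolated (Obs-closed {T}) u∉Obs
    ... | w , a , b , a≢b , a∉Obs , b∉Obs , a-near , b-near =
      T ∪ ⁅ w ⁆ , size ,
      ∣p∣+2≤∣q∣ (Obs-monotone {T} (p⊆p∪q ⁅ w ⁆)) a≢b a∉Obs b∉Obs (observed a-near) (observed b-near)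
      where
      size : ∣ T ∪ ⁅ w ⁆ ∣ ≤ suc ∣ T ∣
      size = ≤-trans (∣p∪q∣≤∣p∣+∣q∣ T ⁅ w ⁆)
                     (≤-reflexive (trans (cong (λ k → ∣ T ∣ + k) (∣⁅x⁆∣≡1 w)) (+-comm ∣ T ∣ 1)))
      observed : ∀ {x} → x ∈ closedNbhd G ⁅ w ⁆ → x ∈ Obs G (T ∪ ⁅ w ⁆)
      observed x-near = closedNbhd⊆Obs {T ∪ ⁅ w ⁆} (closedNbhd-monotone {⁅ w ⁆} (q⊆p∪q T ⁅ w ⁆) x-near)

    unobservedCount : Subset n → ℕ
    unobservedCount T = n ∸ ∣ Obs G T ∣

    unobservedCount-PDS : ∀ S → IsPowerDominating G S → unobservedCount S ≡ 0
    unobservedCount-PDS S dominating = trans (cong (n ∸_) (trans (cong ∣_∣ Obs≡⊤) (∣⊤∣≡n n))) (n∸n≡0 n)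
      where
      Obs≡⊤ : Obs G S ≡ ⊤
      Obs≡⊤ = ⊆-antisym ⊆⊤ (λ {x} _ → lookup⇒∈ (dominating x))

    min-PDS-bound : NoIsolatedVertex → ∀ S → IsMinPowerDominating G S →
                    ∀ T → Acc _<_ (unobservedCount T) → 2 * ∣ S ∣ ≤ 2 * ∣ T ∣ + unobservedCount T
    min-PDS-bound noIsolated S minS@(_ , minimal) T (acc smaller) with all? (_∈? Obs G T)
    ... | yes dominated = ≤-trans (*-monoʳ-≤ 2 (minimal T (∈⇒lookup ∘ dominated))) (m≤m+n _ _)
    ... | no undominated
      with add-vertex-observes-two noIsolated {T} (proj₂ (¬∀⟶∃¬ n _ (_∈? Obs G T) undominated))
    ...   | T′ , size , gain = begin
      2 * ∣ S ∣                              ≤⟨ min-PDS-bound noIsolated S minS T′ (smaller drop′) ⟩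
      2 * ∣ T′ ∣ + unobservedCount T′        ≤⟨ +-monoˡ-≤ (unobservedCount T′) (*-monoʳ-≤ 2 size) ⟩
      2 * suc ∣ T ∣ + unobservedCount T′     ≡⟨ 2*[1+m]+n≡2*m+[2+n] ∣ T ∣ (unobservedCount T′) ⟩
      2 * ∣ T ∣ + (2 + unobservedCount T′)   ≤⟨ +-monoʳ-≤ (2 * ∣ T ∣) drop ⟩
      2 * ∣ T ∣ + unobservedCount T          ∎
      where
      open ≤-Reasoning
      drop : 2 + unobservedCount T′ ≤ unobservedCount T
      drop = m+a≤b⇒m+[n∸b]≤n∸a 2 gain (∣p∣≤n (Obs G T′))
      drop′ : unobservedCount T′ < unobservedCount T
      drop′ = ≤-trans (n≤1+n _) drop

  ℕtoℚ≡mkℚ : ∀ k → ℕtoℚ k ≡ mkℚ (ℤ.+ k) 0 (coprime-sym (1-coprimeTo k))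
  ℕtoℚ≡mkℚ k = ℚ.normalize-coprime (coprime-sym (1-coprimeTo k))

  2*x+y≡[x*2+[1*y]*1]*1 : ∀ x y →
                          ℤ.+ 2 ℤ.* x ℤ.+ y ≡ (x ℤ.* ℤ.+ 2 ℤ.+ (ℤ.+ 1 ℤ.* y) ℤ.* ℤ.+ 1) ℤ.* ℤ.+ 1
  2*x+y≡[x*2+[1*y]*1]*1 = ZSolver.solve-∀
    where import Data.Integer.Tactic.RingSolver as ZSolver

  2s≤2t+d⇒s≤t+½d : ∀ s t d → 2 * s ≤ 2 * t + d → ℕtoℚ s ≤ℚ ℕtoℚ t +ℚ ½ *ℚ ℕtoℚ d
  2s≤2t+d⇒s≤t+½d s t d 2s≤2t+d rewrite ℕtoℚ≡mkℚ s | ℕtoℚ≡mkℚ t | ℕtoℚ≡mkℚ d =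
    ℚ.toℚᵘ-cancel-≤ (ℚᵘ.≤-respʳ-≃ (ℚᵘ.≃-sym toℚᵘ-rhs) (ℚᵘ.*≤* cross-multiplied))
    where
    t′ d′ : ℚ
    t′ = mkℚ (ℤ.+ t) 0 (coprime-sym (1-coprimeTo t))
    d′ = mkℚ (ℤ.+ d) 0 (coprime-sym (1-coprimeTo d))
    toℚᵘ-rhs : toℚᵘ (t′ +ℚ ½ *ℚ d′) ℚᵘ.≃ toℚᵘ t′ ℚᵘ.+ toℚᵘ ½ ℚᵘ.* toℚᵘ d′
    toℚᵘ-rhs = ℚᵘ.≃-trans (ℚ.toℚᵘ-homo-+ t′ (½ *ℚ d′)) (ℚᵘ.+-congʳ (toℚᵘ t′) (ℚ.toℚᵘ-homo-* ½ d′))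
    -- the cross-multiplied form of toℚᵘ (ℕtoℚ s) ≤ toℚᵘ (ℕtoℚ t + ½ * ℕtoℚ d)
    cross-multiplied :
      ℤ.+ s ℤ.* ℤ.+ 2 ℤ.≤ (ℤ.+ t ℤ.* ℤ.+ 2 ℤ.+ (ℤ.+ 1 ℤ.* ℤ.+ d) ℤ.* ℤ.+ 1) ℤ.* ℤ.+ 1
    cross-multiplied = begin
      ℤ.+ s ℤ.* ℤ.+ 2          ≡⟨ ℤ.*-comm (ℤ.+ s) (ℤ.+ 2) ⟩
      ℤ.+ 2 ℤ.* ℤ.+ s          ≡⟨ ℤ.pos-* 2 s ⟨
      ℤ.+ (2 * s)              ≤⟨ ℤ.+≤+ 2s≤2t+d ⟩
      ℤ.+ (2 * t + d)          ≡⟨ ℤ.pos-+ (2 * t) d ⟩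
      ℤ.+ (2 * t) ℤ.+ ℤ.+ d    ≡⟨ cong (ℤ._+ ℤ.+ d) (ℤ.pos-* 2 t) ⟩
      ℤ.+ 2 ℤ.* ℤ.+ t ℤ.+ ℤ.+ d ≡⟨ 2*x+y≡[x*2+[1*y]*1]*1 (ℤ.+ t) (ℤ.+ d) ⟩
      (ℤ.+ t ℤ.* ℤ.+ 2 ℤ.+ (ℤ.+ 1 ℤ.* ℤ.+ d) ℤ.* ℤ.+ 1) ℤ.* ℤ.+ 1 ∎
      where open ℤ.≤-Reasoning

  *-monoˡ-≤-ℕtoℚ : ∀ {p q} k → p ≤ℚ q → p *ℚ ℕtoℚ k ≤ℚ q *ℚ ℕtoℚ k
  *-monoˡ-≤-ℕtoℚ k p≤q rewrite ℕtoℚ≡mkℚ k = ℚ.*-monoʳ-≤-nonNeg (mkℚ (ℤ.+ k) 0 _) p≤q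

  min-PDS-½-bound : ∀ {n} (G : Graph n) → NoIsolatedVertex G → ∀ S → IsMinPowerDominating G S →
                    ∀ T → ℕtoℚ ∣ S ∣ ≤ℚ ℕtoℚ ∣ T ∣ +ℚ ½ *ℚ ℕtoℚ (unobservedCount G T)
  min-PDS-½-bound G noIsolated S minS T =
    2s≤2t+d⇒s≤t+½d ∣ S ∣ ∣ T ∣ _ (min-PDS-bound G noIsolated S minS T (<-wellFounded _))

  cost-PDS : ∀ {n} (G : Graph n) β S → IsPowerDominating G S → cost G S β ≡ ℕtoℚ ∣ S ∣
  cost-PDS G β S dominating = begin
    ℕtoℚ ∣ S ∣ +ℚ β *ℚ ℕtoℚ (unobservedCount G S)
      ≡⟨ cong (λ k → ℕtoℚ ∣ S ∣ +ℚ β *ℚ ℕtoℚ k) (unobservedCount-PDS G S dominating) ⟩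
    ℕtoℚ ∣ S ∣ +ℚ β *ℚ ℕtoℚ 0
      ≡⟨ cong (ℕtoℚ ∣ S ∣ +ℚ_) (ℚ.*-zeroʳ β) ⟩
    ℕtoℚ ∣ S ∣ +ℚ ℕtoℚ 0
      ≡⟨ ℚ.+-identityʳ (ℕtoℚ ∣ S ∣) ⟩
    ℕtoℚ ∣ S ∣
      ∎
    where open ≡-Reasoning

open import Data.Nat using (ℕ)
open import Data.Fin.Subset using (Subset; ∣_∣)
open import Data.Product using (_,_)
open import Data.Rational using (ℚ; ½; _≤_; _+_; _*_)
import Data.Rational.Properties as ℚ
open PowerDomination
  using (NoIsolatedVertex; forts-nontrivial⇒NoIsolatedVertex; unobservedCount; min-PDS-½-bound;
         cost-PDS; *-monoˡ-≤-ℕtoℚ)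

proposition3p8 : (n : ℕ) (G : Graph n) → MinFortSize G 2 →
    (β : ℚ) → ½ ≤ β →
    (S : Subset n) → IsMinPowerDominating G S → IsBetaBest G β S
proposition3p8 n G (_ , forts≥2) β ½≤β S minS@(dominating , _) T = begin
  cost G S β                        ≡⟨ cost-PDS G β S dominating ⟩
  ℕtoℚ ∣ S ∣                        ≤⟨ min-PDS-½-bound G noIsolated S minS T ⟩
  ℕtoℚ ∣ T ∣ + ½ * ℕtoℚ d           ≤⟨ ℚ.+-monoʳ-≤ (ℕtoℚ ∣ T ∣) (*-monoˡ-≤-ℕtoℚ d ½≤β) ⟩
  cost G T β                        ∎
  where
  open ℚ.≤-Reasoning
  noIsolated : NoIsolatedVertex G
  noIsolated = forts-nontrivial⇒NoIsolatedVertex G forts≥2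
  d : ℕ
  d = unobservedCount G T
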